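{- Let $\langle R,\circ,e,-,\infty\rangle$ be a CBI-model. Then: (1) for all $x \in R$, $-(-x) = x$; (2) $-e = \infty$; (3) for all $x,y,z \in R$: $z \in x \circ y$ iff $-x \in y \circ (-z)$ iff $-y \in x \circ (-z)$.
   Context: A BBI-model is a tuple $\langle R,\circ,e\rangle$ with $e \in R$ and $\circ : R \times R \to \mathcal{P}(R)$ (where $\mathcal{P}(R)$ is the powerset of $R$) such that $\circ$ is commutative and associative and $r \circ e = \{r\}$ for all $r \in R$; associativity is understood with respect to the pointwise extension $X \circ Y = \bigcup_{x\in X, y \in Y} x \circ y$ of $\circ$ to subsets. A CBI-model is a tuple $\langle R,\circ,e,-,\infty\rangle$ where $\langle R,\circ,e\rangle$ is a BBI-model, $- : R \to R$ and $\infty \in R$, such that for each $x \in R$, $-x$ is the unique element of $R$ satisfying $\infty \in x \circ (-x)$. -}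

module Defs where

open import Level using (Level; _⊔_; suc)
open import Data.Product using (Σ; ∃; ∃-syntax; _×_; _,_)
open import Relation.Binary.PropositionalEquality using (_≡_)
open import Function.Bundles using (_⇔_)

-- A multiplication  ∘ : R × R → P(R)  is represented by its membership
-- relation:  Op R  with  op x y z  meaning  z ∈ x ∘ y.
Op : ∀ {a} (R : Set a) → Set (suc a)
Op {a} R = R → R → R → Set a

-- membership in the pointwise extension  (x ∘ y) ∘ z
-- w ∈ (x ∘ y) ∘ z  iff  ∃ t ∈ x ∘ y with w ∈ t ∘ z
_∈[_∘_]∘_by_ : ∀ {a} {R : Set a} → R → R → R → R → Op R → Set a
w ∈[ x ∘ y ]∘ z by op = ∃[ t ] (op x y t × op t z w)

_∈_∘[_∘_]by_ : ∀ {a} {R : Set a} → R → R → R → R → Op R → Set a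
w ∈ x ∘[ y ∘ z ]by op = ∃[ t ] (op y z t × op x t w)

-- BBI-model ⟨R, ∘, e⟩ (equality of subsets = extensional equality of
-- membership)
record IsBBI {a} (R : Set a) (op : Op R) (e : R) : Set a where
  field
    comm  : ∀ x y w → op x y w ⇔ op y x w
    assoc : ∀ x y z w → (w ∈[ x ∘ y ]∘ z by op) ⇔ (w ∈ x ∘[ y ∘ z ]by op)
    unit  : ∀ r w → op r e w ⇔ (w ≡ r)

record IsCBI {a} (R : Set a) (op : Op R) (e : R) (neg : R → R) (∞ : R) : Set a where
  field
    isBBI    : IsBBI R op e
    neg-inv  : ∀ x → op x (neg x) ∞
    neg-uniq : ∀ x y → op x y ∞ → y ≡ neg x

module Submission where

-- Write  z ∈ x ∘ y  for  op x y z.  Uniqueness of negation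
-- turns any witness of  ∞ ∈ x ∘ y  into the equation  y ≡ -x.
--  (1) ∞ ∈ (-x) ∘ x  by commutativity, so  x = -(-x).
--  (2) ∞ ∈ e ∘ ∞  by the unit law, so  ∞ = -e.
--  (3) The key fact is the "rotation"  z ∈ x ∘ y ⇒ -x ∈ y ∘ (-z):
--      ∞ ∈ (x ∘ y) ∘ (-z), so by associativity ∞ ∈ x ∘ t for some
--      t ∈ y ∘ (-z), and uniqueness forces t = -x.  Iterating the rotation
--      (x, y, z) ↦ (y, -z, -x) three times returns to (x, y, z) up to
--      double negations, which (1) removes; hence the rotation is
--      invertible.  Combining it with commutativity gives all the stated
--      equivalences.

open import Defs
open import Data.Product using (_×_; _,_)
open import Relation.Binary.PropositionalEquality using (_≡_; refl; sym; subst; subst₂)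
open import Function.Bundles using (_⇔_; mk⇔; Equivalence)

module CBIProperties {a} {R : Set a} {op : Op R} {e : R} {neg : R → R} {∞ : R}
                     (isCBI : IsCBI R op e neg ∞) where
  open IsCBI isCBI
  open IsBBI isBBI
  open Equivalence using (to; from)

  swap : ∀ {x y z} → op x y z → op y x z
  swap {x} {y} {z} = to (comm x y z)

  neg-involutive : ∀ x → neg (neg x) ≡ x
  neg-involutive x = sym (neg-uniq (neg x) x (swap (neg-inv x)))

  neg-unit : neg e ≡ ∞
  neg-unit = sym (neg-uniq e ∞ (swap (from (unit ∞ ∞) refl)))

  -- The rotation: z ∈ x ∘ y implies -x ∈ y ∘ (-z).  Associativity splits
  -- ∞ ∈ (x ∘ y) ∘ (-z) through some t ∈ y ∘ (-z) with ∞ ∈ x ∘ t, and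
  -- uniqueness of negation identifies t with -x.
  rotate : ∀ {x y z} → op x y z → op y (neg z) (neg x)
  rotate {x} {y} {z} z∈xy with to (assoc x y (neg z) ∞) (z , z∈xy , neg-inv z)
  ... | t , t∈y-z , ∞∈xt = subst (op y (neg z)) (neg-uniq x t ∞∈xt) t∈y-z

  -- Rotating twice more undoes a rotation once double negations are
  -- cancelled:  -x ∈ y ∘ (-z)  ⇒  -y ∈ (-z) ∘ x  ⇒  z ∈ x ∘ y.
  unrotate : ∀ {x y z} → op y (neg z) (neg x) → op x y z
  unrotate {x} {y} {z} -x∈y-z =
    subst₂ (op x) (neg-involutive y) (neg-involutive z)
      (rotate (subst (λ w → op (neg z) w (neg y)) (neg-involutive x)
                (rotate -x∈y-z)))

  rotate-⇔ : ∀ x y z → op x y z ⇔ op y (neg z) (neg x)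
  rotate-⇔ x y z = mk⇔ rotate unrotate

  -- (3b) -x ∈ y ∘ (-z)  iff  -y ∈ x ∘ (-z): both are rotations of
  -- z ∈ x ∘ y, the second after commuting the factors.
  rotate-swap-⇔ : ∀ x y z → op y (neg z) (neg x) ⇔ op x (neg z) (neg y)
  rotate-swap-⇔ x y z =
    mk⇔ (λ h → rotate (swap (unrotate h))) (λ h → rotate (swap (unrotate h)))

proposition2p3 : ∀ {a} (R : Set a) (op : Op R) (e : R) (neg : R → R) (∞ : R) →
    IsCBI R op e neg ∞ →
    (∀ x → neg (neg x) ≡ x)
    × (neg e ≡ ∞)
    × (∀ x y z → (op x y z ⇔ op y (neg z) (neg x))
                 × (op y (neg z) (neg x) ⇔ op x (neg z) (neg y)))
proposition2p3 R op e neg ∞ isCBI =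
  neg-involutive , neg-unit , λ x y z → rotate-⇔ x y z , rotate-swap-⇔ x y z
  where open CBIProperties isCBI
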